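{- For integers $n,k$ with $n\ge 2$ and $2\le k\le 2^{n-1}$, $\sigma_{n,k-1}\,(k-1)!=\sigma_{k,n-1}\,(n-1)!$.
   Context: A bipartition of a set $S$ is a partition of $S$ into at most two nonempty components; it is proper if it has exactly two components. A bipartition cuts two elements if they lie in different components. A family of bipartitions of $S$ is a separating family for $S$ if every two distinct elements of $S$ are cut by some bipartition in the family. $\sigma_{a,b}$ is the number of separating families consisting of $b$ distinct proper bipartitions of a fixed $a$-element set. -}

module Defs where

open import Data.Bool using (Bool; true; false)
open import Data.Nat using (ℕ; zero; suc; _*_)
open import Data.Fin using (Fin)
open import Data.Fin.Subset using (Subset; ∁; Nonempty)
open import Data.Fin.Subset.Properties using (nonempty?)
open import Data.Fin.Properties using (all?)
open import Data.Vec using (Vec; []; _∷_; lookup)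
open import Data.Vec.Properties using (≡-dec)
open import Data.List using (List; []; _∷_; map; _++_; length; filter)
open import Data.List.Relation.Unary.All using (All)
open import Data.List.Relation.Unary.All.Properties using ()
import Data.List.Relation.Unary.All as All
open import Data.List.Relation.Unary.Any using (Any)
import Data.List.Relation.Unary.Any as Any
open import Data.List.Membership.Propositional using (_∈_)
open import Data.List.Membership.DecPropositional using (_∈?_)
open import Data.Product using (_×_)
open import Relation.Binary.PropositionalEquality using (_≡_; _≢_)
open import Relation.Nullary using (Dec; ¬_)
open import Relation.Nullary.Decidable using (_×-dec_; _→-dec_; ¬?)
import Data.Bool.Properties as BoolP
import Data.Nat.Properties as NatP
import Data.Fin.Properties as FinP

allSubsets : (a : ℕ) → List (Subset a)
allSubsets zero    = [] ∷ []
allSubsets (suc a) = map (false ∷_) (allSubsets a) ++ map (true ∷_) (allSubsets a)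

sublists : ∀ {ℓ} {A : Set ℓ} → List A → List (List A)
sublists []       = [] ∷ []
sublists (x ∷ xs) = sublists xs ++ map (x ∷_) (sublists xs)

_≟ˢ_ : ∀ {a} (X Y : Subset a) → Dec (X ≡ Y)
_≟ˢ_ = ≡-dec BoolP._≟_

-- A family of bipartitions of Fin a is encoded by the (finite) set C of all
-- components of its members: C ⊆ 𝒫(Fin a), given as a sublist of allSubsets a.
-- The bipartition {X, ∁ X} belongs to the family iff X ∈ C.
-- C encodes a family of b distinct PROPER bipartitions iff
--   * every X ∈ C is nonempty with nonempty complement (proper: two nonempty components),
--   * C is closed under complement (each bipartition contributes both components),
--   * |C| = 2 b (the b bipartitions are distinct, each having two distinct components).
IsProperFamily : (a b : ℕ) → List (Subset a) → Set
IsProperFamily a b C =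
  All (λ X → Nonempty X × Nonempty (∁ X)) C
  × All (λ X → ∁ X ∈ C) C
  × length C ≡ 2 * b

Cuts : ∀ {a} → Subset a → Fin a → Fin a → Set
Cuts X i j = lookup X i ≢ lookup X j

Separating : (a : ℕ) → List (Subset a) → Set
Separating a C = ∀ (i j : Fin a) → i ≢ j → Any (λ X → Cuts X i j) C

IsSepFamily : (a b : ℕ) → List (Subset a) → Set
IsSepFamily a b C = IsProperFamily a b C × Separating a C

isSepFamily? : (a b : ℕ) (C : List (Subset a)) → Dec (IsSepFamily a b C)
isSepFamily? a b C =
  (All.all? (λ X → nonempty? X ×-dec nonempty? (∁ X)) C
   ×-dec All.all? (λ X → _∈?_ _≟ˢ_ (∁ X) C) C
   ×-dec NatP._≟_ (length C) (2 * b))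
  ×-dec all? (λ i → all? (λ j →
          ¬? (FinP._≟_ i j) →-dec Any.any? (λ X → ¬? (BoolP._≟_ (lookup X i) (lookup X j))) C))

σ : ℕ → ℕ → ℕ
σ a b = length (filter (isSepFamily? a b) (sublists (allSubsets a)))

-- Exactly one of the two components of a proper bipartition of {0, …, n-1} avoids 0, so a family
-- of k-1 proper bipartitions is determined by its k-1 components avoiding 0, which are subsets of
-- {1, …, n-1}; the family separates iff these subsets are nonempty, separate the points of
-- {1, …, n-1} from each other and cover them (which separates each point from 0).  Listing the
-- subsets in one of the (k-1)! possible orders turns the family into a (k-1) × (n-1) 0/1 matrix
-- with distinct nonzero rows and distinct nonzero columns, and every such matrix arises exactly
-- once.  So both sides of the identity count these matrices, up to transposition.

module Submission where

open import Defs
open import Data.Bool using (Bool; true; false; not)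
import Data.Bool.Properties as Bool
open import Data.Empty using (⊥-elim)
open import Data.Fin using (Fin; zero; suc; punchIn; punchOut)
import Data.Fin.Properties as Fin
open import Data.Fin.Subset using (Subset; ∁; Nonempty)
open import Data.List using (List; []; _∷_; map; _++_; length; filter; cartesianProduct; cartesianProductWith; allFin)
import Data.List.Properties as List
import Data.List.Membership.DecPropositional as DecMembership
open import Data.List.Membership.Propositional using (_∈_; _∉_; find; lose)
open import Data.List.Membership.Propositional.Properties
open import Data.List.Relation.Binary.Subset.Propositional using (_⊆_)
import Data.List.Relation.Binary.Subset.Propositional.Properties as Subset
open import Data.List.Relation.Unary.All as All using (All; []; _∷_)
open import Data.List.Relation.Unary.All.Properties using (¬All⇒Any¬)
open import Data.List.Relation.Unary.Any using (Any; here; there)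
open import Data.List.Relation.Unary.AllPairs using ([]; _∷_)
open import Data.List.Relation.Unary.Unique.Propositional using (Unique)
import Data.List.Relation.Unary.Unique.Propositional.Properties as Unique
open import Data.Nat using (ℕ; zero; suc; _+_; _*_; _∸_; _^_; _≤_; z≤n; s≤s; _!)
open import Data.Nat.Properties
  using (≤-antisym; +-suc; +-identityʳ; +-comm; *-comm; *-assoc; *-zeroʳ; *-distribˡ-+; *-cancelˡ-≡; suc-injective; 1+n≢0)
import Data.Nat.Properties as ℕ
open import Data.Product using (∃; _×_; _,_; proj₁; proj₂)
open import Data.Sum using (_⊎_; inj₁; inj₂)
open import Data.Vec using (Vec; []; _∷_; lookup; toList; tabulate; insertAt; removeAt)
import Data.Vec.Properties as Vec
import Data.Vec.Membership.Propositional.Properties as VecMem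
import Data.Vec.Relation.Unary.All as VecAll
import Data.Vec.Relation.Unary.All.Properties as VecAll
import Data.Vec.Relation.Unary.Any as VecAny
import Data.Vec.Relation.Unary.Any.Properties as VecAny
open import Function using (_∘_; id; flip)
open import Level using (0ℓ)
open import Relation.Binary.Definitions using (DecidableEquality)
open import Relation.Binary.PropositionalEquality
open import Relation.Nullary using (Dec; yes; no; ¬_)
open import Relation.Nullary.Decidable using (_×-dec_; _→-dec_; ¬?)
open import Relation.Unary using (Pred; Decidable)

-- Counting

module _ {A : Set} where

  count : {P : Pred A 0ℓ} → Decidable P → List A → ℕ
  count P? xs = length (filter P? xs)

  ⊆-delete : ∀ {x : A} {xs} ys₁ {ys₂} → All (x ≢_) xs → x ∷ xs ⊆ ys₁ ++ x ∷ ys₂ → xs ⊆ ys₁ ++ ys₂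
  ⊆-delete ys₁ x≢xs sub z∈xs with ∈-++⁻ ys₁ (sub (there z∈xs))
  ... | inj₁ z∈ys₁         = ∈-++⁺ˡ z∈ys₁
  ... | inj₂ (here refl)   = ⊥-elim (All.lookup x≢xs z∈xs refl)
  ... | inj₂ (there z∈ys₂) = ∈-++⁺ʳ ys₁ z∈ys₂

  length-≤-⊆ : {xs ys : List A} → Unique xs → xs ⊆ ys → length xs ≤ length ys
  length-≤-⊆ [] _ = z≤n
  length-≤-⊆ {x ∷ xs} (x≢xs ∷ xs!) xs⊆ys with ys₁ , ys₂ , refl ← ∈-∃++ (xs⊆ys (here refl)) =
    subst (suc (length xs) ≤_) (sym (List.length-++-sucʳ ys₁ x ys₂))
      (s≤s (length-≤-⊆ xs! (⊆-delete ys₁ x≢xs xs⊆ys)))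

  filter-cong-on : {P Q : Pred A 0ℓ} (P? : Decidable P) (Q? : Decidable Q) (xs : List A) →
    (∀ {x} → x ∈ xs → P x → Q x) → (∀ {x} → x ∈ xs → Q x → P x) → filter P? xs ≡ filter Q? xs
  filter-cong-on P? Q? [] _ _ = refl
  filter-cong-on P? Q? (x ∷ xs) P⇒Q Q⇒P with P? x | Q? x
  ... | yes _  | yes _  = cong (x ∷_) (filter-cong-on P? Q? xs (P⇒Q ∘ there) (Q⇒P ∘ there))
  ... | yes px | no ¬qx = ⊥-elim (¬qx (P⇒Q (here refl) px))
  ... | no ¬px | yes qx = ⊥-elim (¬px (Q⇒P (here refl) qx))
  ... | no _   | no _   = filter-cong-on P? Q? xs (P⇒Q ∘ there) (Q⇒P ∘ there)

  count-++ : {P : Pred A 0ℓ} (P? : Decidable P) (xs ys : List A) →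
    count P? (xs ++ ys) ≡ count P? xs + count P? ys
  count-++ P? xs ys = trans (cong length (List.filter-++ P? xs ys)) (List.length-++ (filter P? xs))

  count-none : {P : Pred A 0ℓ} (P? : Decidable P) (xs : List A) → (∀ {x} → x ∈ xs → ¬ P x) → count P? xs ≡ 0
  count-none P? xs ¬P = cong length (List.filter-none P? (All.tabulate ¬P))

  count-split : {P Q : Pred A 0ℓ} (P? : Decidable P) (Q? : Decidable Q) (xs : List A) →
    count P? xs ≡ count (λ x → P? x ×-dec Q? x) xs + count (λ x → P? x ×-dec ¬? (Q? x)) xs
  count-split P? Q? [] = refl
  count-split P? Q? (x ∷ xs) with P? x | Q? x
  ... | yes _ | yes _ = cong suc (count-split P? Q? xs)
  ... | yes _ | no _  = trans (cong suc (count-split P? Q? xs)) (sym (+-suc _ _))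
  ... | no _  | yes _ = count-split P? Q? xs
  ... | no _  | no _  = count-split P? Q? xs

module _ {A B : Set} where

  count-map : {P : Pred B 0ℓ} (P? : Decidable P) (f : A → B) (xs : List A) →
    count P? (map f xs) ≡ count (P? ∘ f) xs
  count-map P? f [] = refl
  count-map P? f (x ∷ xs) with P? (f x)
  ... | yes _ = cong suc (count-map P? f xs)
  ... | no _  = count-map P? f xs

module _ {A B : Set} where

  count-cartesianProduct : {P : Pred B 0ℓ} (P? : Decidable P) (xs : List A) (ys : List B) →
    count (λ xy → P? (proj₂ xy)) (cartesianProduct xs ys) ≡ length xs * count P? ys
  count-cartesianProduct P? [] ys = refl
  count-cartesianProduct P? (x ∷ xs) ys = begin
    count (λ xy → P? (proj₂ xy)) (map (x ,_) ys ++ cartesianProduct xs ys)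
      ≡⟨ count-++ (λ xy → P? (proj₂ xy)) (map (x ,_) ys) (cartesianProduct xs ys) ⟩
    count (λ xy → P? (proj₂ xy)) (map (x ,_) ys) + count (λ xy → P? (proj₂ xy)) (cartesianProduct xs ys)
      ≡⟨ cong₂ _+_ (count-map (λ xy → P? (proj₂ xy)) (x ,_) ys) (count-cartesianProduct P? xs ys) ⟩
    count P? ys + length xs * count P? ys ∎
    where open ≡-Reasoning

  Unique-map-injectiveOn : (f : A → B) {xs : List A} → Unique xs →
    (∀ {a a'} → a ∈ xs → a' ∈ xs → f a ≡ f a' → a ≡ a') → Unique (map f xs)
  Unique-map-injectiveOn f [] _ = []
  Unique-map-injectiveOn f {x ∷ xs} (x≢xs ∷ xs!) inj =
    All.tabulate fx≢ ∷ Unique-map-injectiveOn f xs! (λ a∈ a'∈ → inj (there a∈) (there a'∈))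
    where
    fx≢ : ∀ {b} → b ∈ map f xs → f x ≢ b
    fx≢ b∈ fx≡b with a , a∈ , refl ← ∈-map⁻ f b∈ = All.lookup x≢xs a∈ (inj (here refl) (there a∈) fx≡b)

  count-≤-injectiveOn : {P : Pred A 0ℓ} {Q : Pred B 0ℓ} (P? : Decidable P) (Q? : Decidable Q)
    (xs : List A) (ys : List B) (f : A → B) → Unique xs →
    (∀ {a} → a ∈ xs → P a → f a ∈ ys × Q (f a)) →
    (∀ {a a'} → a ∈ xs → a' ∈ xs → P a → P a' → f a ≡ f a' → a ≡ a') →
    count P? xs ≤ count Q? ys
  count-≤-injectiveOn P? Q? xs ys f xs! into inj =
    subst (_≤ count Q? ys) (List.length-map f (filter P? xs))
      (length-≤-⊆ (Unique-map-injectiveOn f (Unique.filter⁺ P? xs!) inj′) image⊆)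
    where
    inj′ : ∀ {a a'} → a ∈ filter P? xs → a' ∈ filter P? xs → f a ≡ f a' → a ≡ a'
    inj′ a∈ a'∈ with a∈xs , pa ← ∈-filter⁻ P? {xs = xs} a∈ | a'∈xs , pa' ← ∈-filter⁻ P? {xs = xs} a'∈ =
      inj a∈xs a'∈xs pa pa'
    image⊆ : map f (filter P? xs) ⊆ filter Q? ys
    image⊆ b∈ with a , a∈ , refl ← ∈-map⁻ f b∈ =
      let a∈xs , pa = ∈-filter⁻ P? {xs = xs} a∈ in ∈-filter⁺ Q? (proj₁ (into a∈xs pa)) (proj₂ (into a∈xs pa))

module _ {A B : Set} where

  count-≡-inverseOn : {P : Pred A 0ℓ} {Q : Pred B 0ℓ} (P? : Decidable P) (Q? : Decidable Q)
    (xs : List A) (ys : List B) (f : A → B) (g : B → A) → Unique xs → Unique ys →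
    (∀ {a} → a ∈ xs → P a → f a ∈ ys × Q (f a)) →
    (∀ {b} → b ∈ ys → Q b → g b ∈ xs × P (g b)) →
    (∀ {a} → a ∈ xs → P a → g (f a) ≡ a) →
    (∀ {b} → b ∈ ys → Q b → f (g b) ≡ b) →
    count P? xs ≡ count Q? ys
  count-≡-inverseOn P? Q? xs ys f g xs! ys! f-into g-into gf≡id fg≡id = ≤-antisym
    (count-≤-injectiveOn P? Q? xs ys f xs! f-into
      (λ a∈ a'∈ pa pa' fa≡fa' → trans (sym (gf≡id a∈ pa)) (trans (cong g fa≡fa') (gf≡id a'∈ pa'))))
    (count-≤-injectiveOn Q? P? ys xs g ys! g-into
      (λ b∈ b'∈ qb qb' gb≡gb' → trans (sym (fg≡id b∈ qb)) (trans (cong f gb≡gb') (fg≡id b'∈ qb'))))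

-- Exhaustive enumerations

allSubsets-complete : ∀ {a} (X : Subset a) → X ∈ allSubsets a
allSubsets-complete [] = here refl
allSubsets-complete {suc a} (false ∷ X) = ∈-++⁺ˡ (∈-map⁺ (false ∷_) (allSubsets-complete X))
allSubsets-complete {suc a} (true ∷ X) =
  ∈-++⁺ʳ (map (false ∷_) (allSubsets a)) (∈-map⁺ (true ∷_) (allSubsets-complete X))

allSubsets-unique : ∀ a → Unique (allSubsets a)
allSubsets-unique zero = [] ∷ []
allSubsets-unique (suc a) =
  Unique.++⁺ (Unique.map⁺ Vec.∷-injectiveʳ (allSubsets-unique a))
             (Unique.map⁺ Vec.∷-injectiveʳ (allSubsets-unique a)) disjoint
  where
  disjoint : ∀ {X} → ¬ (X ∈ map (false ∷_) (allSubsets a) × X ∈ map (true ∷_) (allSubsets a))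
  disjoint (X∈ , X∈′) with _ , _ , refl ← ∈-map⁻ (false ∷_) X∈ | _ , _ , () ← ∈-map⁻ (true ∷_) X∈′

module _ {A : Set} where

  vecsOver : List A → (b : ℕ) → List (Vec A b)
  vecsOver U zero    = [] ∷ []
  vecsOver U (suc b) = cartesianProductWith _∷_ U (vecsOver U b)

  ∈-vecsOver⁺ : (U : List A) {b : ℕ} (v : Vec A b) → (∀ i → lookup v i ∈ U) → v ∈ vecsOver U b
  ∈-vecsOver⁺ U []      _   = here refl
  ∈-vecsOver⁺ U (x ∷ v) v⊆U = ∈-cartesianProductWith⁺ _∷_ (v⊆U zero) (∈-vecsOver⁺ U v (v⊆U ∘ suc))

  ∈-vecsOver⁻ : (U : List A) {b : ℕ} (v : Vec A b) → v ∈ vecsOver U b → ∀ i → lookup v i ∈ U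
  ∈-vecsOver⁻ U {suc b} (x ∷ v) v∈ i with ∈-cartesianProductWith⁻ _∷_ U (vecsOver U b) v∈
  ∈-vecsOver⁻ U {suc b} (x ∷ v) v∈ zero    | _ , _ , x∈U , _   , refl = x∈U
  ∈-vecsOver⁻ U {suc b} (x ∷ v) v∈ (suc i) | _ , _ , _   , v∈′ , refl = ∈-vecsOver⁻ U v v∈′ i

  vecsOver-unique : (U : List A) → Unique U → ∀ b → Unique (vecsOver U b)
  vecsOver-unique U U! zero    = [] ∷ []
  vecsOver-unique U U! (suc b) = Unique.cartesianProductWith⁺ _∷_ Vec.∷-injective U! (vecsOver-unique U U! b)

  sublists-⊆ : (U : List A) {C : List A} → C ∈ sublists U → C ⊆ U
  sublists-⊆ [] (here refl) ()
  sublists-⊆ (x ∷ U) C∈ z∈C with ∈-++⁻ (sublists U) C∈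
  ... | inj₁ C∈′ = there (sublists-⊆ U C∈′ z∈C)
  ... | inj₂ xC∈ with C′ , C′∈ , refl ← ∈-map⁻ (x ∷_) xC∈ with z∈C
  ...   | here refl = here refl
  ...   | there z∈C′ = there (sublists-⊆ U C′∈ z∈C′)

  sublists-unique : (U : List A) → Unique U → Unique (sublists U)
  sublists-unique [] _ = [] ∷ []
  sublists-unique (x ∷ U) (x≢U ∷ U!) =
    Unique.++⁺ (sublists-unique U U!) (Unique.map⁺ List.∷-injectiveʳ (sublists-unique U U!)) disjoint
    where
    disjoint : ∀ {C} → ¬ (C ∈ sublists U × C ∈ map (x ∷_) (sublists U))
    disjoint (C∈ , xC∈) with _ , _ , refl ← ∈-map⁻ (x ∷_) xC∈ = All.lookup x≢U (sublists-⊆ U C∈ (here refl)) refl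

  filter∈sublists : {P : Pred A 0ℓ} (P? : Decidable P) (U : List A) → filter P? U ∈ sublists U
  filter∈sublists P? [] = here refl
  filter∈sublists P? (x ∷ U) with P? x
  ... | yes _ = ∈-++⁺ʳ (sublists U) (∈-map⁺ (x ∷_) (filter∈sublists P? U))
  ... | no _  = ∈-++⁺ˡ (filter∈sublists P? U)

module _ {A : Set} (_≟_ : DecidableEquality A) where
  open import Data.List.Membership.DecPropositional _≟_ using (_∈?_)

  sublist≡filter-∈ : (U : List A) → Unique U → {C : List A} → C ∈ sublists U → C ≡ filter (_∈? C) U
  sublist≡filter-∈ [] _ (here refl) = refl
  sublist≡filter-∈ (x ∷ U) (x≢U ∷ U!) {C} C∈ with ∈-++⁻ (sublists U) C∈
  ... | inj₁ C∈′ = begin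
    C                   ≡⟨ sublist≡filter-∈ U U! C∈′ ⟩
    filter (_∈? C) U    ≡⟨ List.filter-reject (_∈? C) (λ x∈C → All.lookup x≢U (sublists-⊆ U C∈′ x∈C) refl) ⟨
    filter (_∈? C) (x ∷ U) ∎
    where open ≡-Reasoning
  ... | inj₂ xC∈ with C′ , C′∈ , refl ← ∈-map⁻ (x ∷_) xC∈ = begin
    x ∷ C′                    ≡⟨ cong (x ∷_) (sublist≡filter-∈ U U! C′∈) ⟩
    x ∷ filter (_∈? C′) U     ≡⟨ cong (x ∷_) (filter-cong-on (_∈? C′) (_∈? x ∷ C′) U (λ _ → there) ∈C′) ⟩
    x ∷ filter (_∈? x ∷ C′) U ≡⟨ List.filter-accept (_∈? x ∷ C′) (here refl) ⟨
    filter (_∈? x ∷ C′) (x ∷ U) ∎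
    where
    open ≡-Reasoning
    ∈C′ : ∀ {y} → y ∈ U → y ∈ x ∷ C′ → y ∈ C′
    ∈C′ y∈U (here refl) = ⊥-elim (All.lookup x≢U y∈U refl)
    ∈C′ _   (there y∈C′) = y∈C′

-- Ordered versus unordered selections

LookupInjective : ∀ {A : Set} {b} → Vec A b → Set
LookupInjective {b = b} v = ∀ (i j : Fin b) → lookup v i ≡ lookup v j → i ≡ j

Contains : ∀ {A : Set} {b} → A → Vec A b → Set
Contains x v = ∃ λ i → lookup v i ≡ x

SetInvariant : ∀ {A : Set} → (List A → Set) → Set
SetInvariant P = ∀ {L L′} → L ⊆ L′ → L′ ⊆ L → P L → P L′

module _ {A : Set} where

  lookup-removeAt : ∀ {b} (v : Vec A (suc b)) (i : Fin (suc b)) (j : Fin b) →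
    lookup (removeAt v i) j ≡ lookup v (punchIn i j)
  lookup-removeAt v i j = trans (cong (lookup (removeAt v i)) (sym (Fin.punchOut-punchIn i)))
                                (Vec.removeAt-punchOut v (Fin.punchInᵢ≢i i j ∘ sym))

  pivot⊎punchIn : ∀ {b} (i k : Fin (suc b)) → k ≡ i ⊎ ∃ λ j → k ≡ punchIn i j
  pivot⊎punchIn i k with k Fin.≟ i
  ... | yes k≡i = inj₁ k≡i
  ... | no k≢i  = inj₂ (punchOut (k≢i ∘ sym) , sym (Fin.punchIn-punchOut (k≢i ∘ sym)))

  lookup∈toList : ∀ {b} (v : Vec A b) (k : Fin b) → lookup v k ∈ toList v
  lookup∈toList v k = VecMem.∈-toList⁺ (VecMem.∈-lookup k v)

  ∈-toList⇒Contains : ∀ {b} (v : Vec A b) {z} → z ∈ toList v → Contains z v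
  ∈-toList⇒Contains v z∈ = let p = VecMem.∈-toList⁻ z∈ in VecAny.index p , sym (VecAny.lookup-index p)

  toList-insertAt-⊆ : ∀ {b} (w : Vec A b) i x → toList (insertAt w i x) ⊆ x ∷ toList w
  toList-insertAt-⊆ w i x z∈ with k , refl ← ∈-toList⇒Contains (insertAt w i x) z∈ with pivot⊎punchIn i k
  ... | inj₁ refl       = here (Vec.insertAt-lookup w i x)
  ... | inj₂ (j , refl) = there (subst (_∈ toList w) (sym (Vec.insertAt-punchIn w i x j)) (lookup∈toList w j))

  ⊆-toList-insertAt : ∀ {b} (w : Vec A b) i x → x ∷ toList w ⊆ toList (insertAt w i x)
  ⊆-toList-insertAt w i x (here refl) =
    subst (_∈ toList (insertAt w i x)) (Vec.insertAt-lookup w i x) (lookup∈toList _ i)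
  ⊆-toList-insertAt w i x (there z∈) with j , refl ← ∈-toList⇒Contains w z∈ =
    subst (_∈ toList (insertAt w i x)) (Vec.insertAt-punchIn w i x j) (lookup∈toList _ (punchIn i j))

  insertAt-pivot-unique : ∀ {b} {w : Vec A b} {i x} k → ¬ Contains x w → lookup (insertAt w i x) k ≡ x → k ≡ i
  insertAt-pivot-unique {w = w} {i} {x} k x∉w e with pivot⊎punchIn i k
  ... | inj₁ k≡i        = k≡i
  ... | inj₂ (j , refl) = ⊥-elim (x∉w (j , trans (sym (Vec.insertAt-punchIn w i x j)) e))

  insertAt-lookupInjective : ∀ {b} {w : Vec A b} {x} i → LookupInjective w → ¬ Contains x w →
    LookupInjective (insertAt w i x)
  insertAt-lookupInjective {w = w} {x} i w! x∉w k k′ e with pivot⊎punchIn i k | pivot⊎punchIn i k′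
  ... | inj₁ refl | _ = sym (insertAt-pivot-unique k′ x∉w (trans (sym e) (Vec.insertAt-lookup w i x)))
  ... | inj₂ _ | inj₁ refl = insertAt-pivot-unique k x∉w (trans e (Vec.insertAt-lookup w i x))
  ... | inj₂ (j , refl) | inj₂ (j′ , refl) = cong (punchIn i) (w! j j′
    (trans (sym (Vec.insertAt-punchIn w i x j)) (trans e (Vec.insertAt-punchIn w i x j′))))

  removeAt-lookupInjective : ∀ {b} {v : Vec A (suc b)} i → LookupInjective v → LookupInjective (removeAt v i)
  removeAt-lookupInjective {v = v} i v! j j′ e = Fin.punchIn-injective i j j′
    (v! _ _ (trans (sym (lookup-removeAt v i j)) (trans e (lookup-removeAt v i j′))))

  ∈-vecsOver-insertAt : ∀ {U b} {w : Vec A b} i x → w ∈ vecsOver U b → insertAt w i x ∈ vecsOver (x ∷ U) (suc b)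
  ∈-vecsOver-insertAt {U} {w = w} i x w∈ = ∈-vecsOver⁺ (x ∷ U) _ entry∈
    where
    entry∈ : ∀ k → lookup (insertAt w i x) k ∈ x ∷ U
    entry∈ k with pivot⊎punchIn i k
    ... | inj₁ refl       = here (Vec.insertAt-lookup w i x)
    ... | inj₂ (j , refl) = there (subst (_∈ U) (sym (Vec.insertAt-punchIn w i x j)) (∈-vecsOver⁻ U w w∈ j))

  ∈-vecsOver-removeAt : ∀ {U b} {v : Vec A (suc b)} {x} i → LookupInjective v → lookup v i ≡ x →
    v ∈ vecsOver (x ∷ U) (suc b) → removeAt v i ∈ vecsOver U b
  ∈-vecsOver-removeAt {U} {v = v} {x} i v! vᵢ≡x v∈ = ∈-vecsOver⁺ U _ entry∈
    where
    entry∈ : ∀ j → lookup (removeAt v i) j ∈ U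
    entry∈ j with ∈-vecsOver⁻ (x ∷ U) v v∈ (punchIn i j)
    ... | here e    = ⊥-elim (Fin.punchInᵢ≢i i j (v! _ _ (trans e (sym vᵢ≡x))))
    ... | there e∈U = subst (_∈ U) (sym (lookup-removeAt v i j)) e∈U

module _ {A : Set} (_≟_ : DecidableEquality A) where

  lookupInjective? : ∀ {b} (v : Vec A b) → Dec (LookupInjective v)
  lookupInjective? v = Fin.all? λ i → Fin.all? λ j → (lookup v i ≟ lookup v j) →-dec (i Fin.≟ j)

  contains? : ∀ {b} (x : A) (v : Vec A b) → Dec (Contains x v)
  contains? x v = Fin.any? λ i → lookup v i ≟ x

  countInjectiveVecs : (U : List A) (b : ℕ) {P : List A → Set} → (∀ L → Dec (P L)) → ℕ
  countInjectiveVecs U b P? = count (λ v → lookupInjective? v ×-dec P? (toList v)) (vecsOver U b)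

  countSublistsOfLength : (U : List A) (b : ℕ) {P : List A → Set} → (∀ L → Dec (P L)) → ℕ
  countSublistsOfLength U b P? = count (λ C → (length C ℕ.≟ b) ×-dec P? C) (sublists U)

  countSublistsOfLength-∷ : (x : A) (U : List A) (b : ℕ) {P : List A → Set} (P? : ∀ L → Dec (P L)) →
    countSublistsOfLength (x ∷ U) b P? ≡
      countSublistsOfLength U b P? + count (λ C → (suc (length C) ℕ.≟ b) ×-dec P? (x ∷ C)) (sublists U)
  countSublistsOfLength-∷ x U b P? =
    trans (count-++ (λ C → (length C ℕ.≟ b) ×-dec P? C) (sublists U) (map (x ∷_) (sublists U)))
          (cong (countSublistsOfLength U b P? +_) (count-map (λ C → (length C ℕ.≟ b) ×-dec P? C) (x ∷_) (sublists U)))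

  countSublistsOfLength-∷-zero : (x : A) (U : List A) {P : List A → Set} (P? : ∀ L → Dec (P L)) →
    countSublistsOfLength (x ∷ U) zero P? ≡ countSublistsOfLength U zero P?
  countSublistsOfLength-∷-zero x U P? = begin
    countSublistsOfLength (x ∷ U) zero P?
      ≡⟨ countSublistsOfLength-∷ x U zero P? ⟩
    countSublistsOfLength U zero P? + count (λ C → (suc (length C) ℕ.≟ 0) ×-dec P? (x ∷ C)) (sublists U)
      ≡⟨ cong (countSublistsOfLength U zero P? +_) (count-none _ (sublists U) (λ _ (1+n≡0 , _) → 1+n≢0 1+n≡0)) ⟩
    countSublistsOfLength U zero P? + 0
      ≡⟨ +-identityʳ _ ⟩
    countSublistsOfLength U zero P? ∎
    where open ≡-Reasoning

  countSublistsOfLength-∷-suc : (x : A) (U : List A) (b : ℕ) {P : List A → Set} (P? : ∀ L → Dec (P L)) →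
    countSublistsOfLength (x ∷ U) (suc b) P? ≡
      countSublistsOfLength U (suc b) P? + countSublistsOfLength U b (λ L → P? (x ∷ L))
  countSublistsOfLength-∷-suc x U b P? = trans (countSublistsOfLength-∷ x U (suc b) P?)
    (cong (λ Cs → countSublistsOfLength U (suc b) P? + length Cs)
      (List.filter-≐ _ _ ((λ (1+n≡1+b , p) → suc-injective 1+n≡1+b , p) , (λ (n≡b , p) → cong suc n≡b , p))
        (sublists U)))

  module _ {x : A} {U : List A} (x∉U : x ∉ U) (U! : Unique U)
           {P : List A → Set} (P? : ∀ L → Dec (P L)) (P-inv : SetInvariant P) where

    private
      injective∧P? : ∀ {b} (v : Vec A b) → Dec (LookupInjective v × P (toList v))
      injective∧P? v = lookupInjective? v ×-dec P? (toList v)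

      injective∧P∘x∷? : ∀ {b} (w : Vec A b) → Dec (LookupInjective w × P (x ∷ toList w))
      injective∧P∘x∷? w = lookupInjective? w ×-dec P? (x ∷ toList w)

      x∷U! : Unique (x ∷ U)
      x∷U! = All.tabulate (λ y∈U x≡y → x∉U (subst (_∈ U) (sym x≡y) y∈U)) ∷ U!

    vecsOver-avoids : ∀ {b} {w : Vec A b} → w ∈ vecsOver U b → ¬ Contains x w
    vecsOver-avoids {w = w} w∈ (j , wⱼ≡x) = x∉U (subst (_∈ U) wⱼ≡x (∈-vecsOver⁻ U w w∈ j))

    countInjectiveVecs-avoiding : ∀ b →
      count (λ v → injective∧P? v ×-dec ¬? (contains? x v)) (vecsOver (x ∷ U) b) ≡ countInjectiveVecs U b P?
    countInjectiveVecs-avoiding b = count-≡-inverseOn _ injective∧P? (vecsOver (x ∷ U) b) (vecsOver U b) id id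
      (vecsOver-unique _ x∷U! b) (vecsOver-unique U U! b)
      (λ {v} v∈ (good , x∉v) → ∈-vecsOver⁺ U v (entry∈ v v∈ x∉v) , good)
      (λ {v} v∈ good → ∈-vecsOver⁺ (x ∷ U) v (there ∘ ∈-vecsOver⁻ U v v∈) , good , vecsOver-avoids v∈)
      (λ _ _ → refl) (λ _ _ → refl)
      where
      entry∈ : (v : Vec A b) → v ∈ vecsOver (x ∷ U) b → ¬ Contains x v → ∀ i → lookup v i ∈ U
      entry∈ v v∈ x∉v i with ∈-vecsOver⁻ (x ∷ U) v v∈ i
      ... | here vᵢ≡x = ⊥-elim (x∉v (i , vᵢ≡x))
      ... | there vᵢ∈U = vᵢ∈U

    position : ∀ {b} → Vec A (suc b) → Fin (suc b)
    position v with contains? x v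
    ... | yes (i , _) = i
    ... | no _        = zero

    lookup-position : ∀ {b} (v : Vec A (suc b)) → Contains x v → lookup v (position v) ≡ x
    lookup-position v x∈v with contains? x v
    ... | yes (_ , vᵢ≡x) = vᵢ≡x
    ... | no x∉v         = ⊥-elim (x∉v x∈v)

    split : ∀ {b} → Vec A (suc b) → Fin (suc b) × Vec A b
    split v = position v , removeAt v (position v)

    unsplit : ∀ {b} → Fin (suc b) × Vec A b → Vec A (suc b)
    unsplit (i , w) = insertAt w i x

    unsplit∘split : ∀ {b} (v : Vec A (suc b)) → Contains x v → unsplit (split v) ≡ v
    unsplit∘split v x∈v = begin
      insertAt (removeAt v (position v)) (position v) x                  ≡⟨ cong (insertAt _ _) (lookup-position v x∈v) ⟨
      insertAt (removeAt v (position v)) (position v) (lookup v (position v)) ≡⟨ Vec.insertAt-removeAt v (position v) ⟩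
      v                                                                  ∎
      where open ≡-Reasoning

    split∘unsplit : ∀ {b} (i : Fin (suc b)) {w : Vec A b} → ¬ Contains x w → split (unsplit (i , w)) ≡ (i , w)
    split∘unsplit i {w} x∉w = begin
      position (insertAt w i x) , removeAt (insertAt w i x) (position (insertAt w i x))
        ≡⟨ cong (λ k → k , removeAt (insertAt w i x) k) position≡i ⟩
      i , removeAt (insertAt w i x) i
        ≡⟨ cong (i ,_) (Vec.removeAt-insertAt w i x) ⟩
      i , w ∎
      where
      open ≡-Reasoning
      position≡i : position (insertAt w i x) ≡ i
      position≡i = insertAt-pivot-unique {w = w} {i} {x} _ x∉w
        (lookup-position (insertAt w i x) (i , Vec.insertAt-lookup w i x))

    positionsAndVecs : ∀ b → List (Fin (suc b) × Vec A b)
    positionsAndVecs b = cartesianProduct (allFin (suc b)) (vecsOver U b)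

    split-into : ∀ {b} {v : Vec A (suc b)} → v ∈ vecsOver (x ∷ U) (suc b) →
      (LookupInjective v × P (toList v)) × Contains x v →
      split v ∈ positionsAndVecs b × (LookupInjective (proj₂ (split v)) × P (x ∷ toList (proj₂ (split v))))
    split-into {v = v} v∈ ((v! , Pv) , x∈v) =
      ∈-cartesianProduct⁺ (∈-allFin i) (∈-vecsOver-removeAt i v! (lookup-position v x∈v) v∈) ,
      removeAt-lookupInjective {v = v} i v! ,
      P-inv (toList-insertAt-⊆ w i x) (⊆-toList-insertAt w i x) (subst (P ∘ toList) (sym (unsplit∘split v x∈v)) Pv)
      where
      i = position v
      w = removeAt v i

    unsplit-into : ∀ {b} {iw : Fin (suc b) × Vec A b} → iw ∈ positionsAndVecs b →
      LookupInjective (proj₂ iw) × P (x ∷ toList (proj₂ iw)) →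
      unsplit iw ∈ vecsOver (x ∷ U) (suc b) ×
      (LookupInjective (unsplit iw) × P (toList (unsplit iw))) × Contains x (unsplit iw)
    unsplit-into {b} {i , w} iw∈ (w! , Pw) =
      ∈-vecsOver-insertAt i x w∈ ,
      (insertAt-lookupInjective i w! (vecsOver-avoids w∈) , P-inv (⊆-toList-insertAt w i x) (toList-insertAt-⊆ w i x) Pw) ,
      (i , Vec.insertAt-lookup w i x)
      where
      w∈ : w ∈ vecsOver U b
      w∈ = proj₂ (∈-cartesianProduct⁻ (allFin (suc b)) (vecsOver U b) iw∈)

    countInjectiveVecs-containing : ∀ b →
      count (λ v → injective∧P? v ×-dec contains? x v) (vecsOver (x ∷ U) (suc b)) ≡
        suc b * countInjectiveVecs U b (λ L → P? (x ∷ L))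
    countInjectiveVecs-containing b = begin
      count (λ v → injective∧P? v ×-dec contains? x v) (vecsOver (x ∷ U) (suc b))
        ≡⟨ count-≡-inverseOn (λ v → injective∧P? v ×-dec contains? x v) (λ iw → injective∧P∘x∷? (proj₂ iw))
             _ (positionsAndVecs b) split unsplit
             (vecsOver-unique _ x∷U! (suc b)) (Unique.cartesianProduct⁺ (Unique.allFin⁺ _) (vecsOver-unique U U! b))
             split-into unsplit-into
             (λ {v} _ (_ , x∈v) → unsplit∘split v x∈v)
             (λ iw∈ _ → split∘unsplit _
               (vecsOver-avoids (proj₂ (∈-cartesianProduct⁻ (allFin (suc b)) (vecsOver U b) iw∈)))) ⟩
      count (λ iw → injective∧P∘x∷? (proj₂ iw)) (positionsAndVecs b)
        ≡⟨ count-cartesianProduct injective∧P∘x∷? (allFin (suc b)) (vecsOver U b) ⟩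
      length (allFin (suc b)) * countInjectiveVecs U b (λ L → P? (x ∷ L))
        ≡⟨ cong (_* countInjectiveVecs U b (λ L → P? (x ∷ L))) (List.length-tabulate {n = suc b} id) ⟩
      suc b * countInjectiveVecs U b (λ L → P? (x ∷ L)) ∎
      where open ≡-Reasoning

    countInjectiveVecs-∷ : ∀ b → countInjectiveVecs (x ∷ U) (suc b) P? ≡
      countInjectiveVecs U (suc b) P? + suc b * countInjectiveVecs U b (λ L → P? (x ∷ L))
    countInjectiveVecs-∷ b = begin
      countInjectiveVecs (x ∷ U) (suc b) P?
        ≡⟨ count-split injective∧P? (contains? x) (vecsOver (x ∷ U) (suc b)) ⟩
      count (λ v → injective∧P? v ×-dec contains? x v) (vecsOver (x ∷ U) (suc b)) +
      count (λ v → injective∧P? v ×-dec ¬? (contains? x v)) (vecsOver (x ∷ U) (suc b))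
        ≡⟨ cong₂ _+_ (countInjectiveVecs-containing b) (countInjectiveVecs-avoiding (suc b)) ⟩
      suc b * countInjectiveVecs U b (λ L → P? (x ∷ L)) + countInjectiveVecs U (suc b) P?
        ≡⟨ +-comm (suc b * countInjectiveVecs U b (λ L → P? (x ∷ L))) (countInjectiveVecs U (suc b) P?) ⟩
      countInjectiveVecs U (suc b) P? + suc b * countInjectiveVecs U b (λ L → P? (x ∷ L)) ∎
      where open ≡-Reasoning

  SetInvariant-∷ : ∀ {P : List A → Set} (x : A) → SetInvariant P → SetInvariant (λ L → P (x ∷ L))
  SetInvariant-∷ x P-inv L⊆L′ L′⊆L = P-inv (Subset.∷⁺ʳ x L⊆L′) (Subset.∷⁺ʳ x L′⊆L)

  countInjectiveVecs≡!*countSublistsOfLength : (U : List A) → Unique U → ∀ b {P : List A → Set}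
    (P? : ∀ L → Dec (P L)) → SetInvariant P → countInjectiveVecs U b P? ≡ b ! * countSublistsOfLength U b P?
  countInjectiveVecs≡!*countSublistsOfLength [] _ zero P? _ with P? []
  ... | yes _ = refl
  ... | no _  = refl
  countInjectiveVecs≡!*countSublistsOfLength [] _ (suc b) _ _ = sym (*-zeroʳ (suc b !))
  countInjectiveVecs≡!*countSublistsOfLength (x ∷ U) (_ ∷ U!) zero P? P-inv = begin
    countInjectiveVecs U zero P?            ≡⟨ countInjectiveVecs≡!*countSublistsOfLength U U! zero P? P-inv ⟩
    1 * countSublistsOfLength U zero P?       ≡⟨ cong (1 *_) (countSublistsOfLength-∷-zero x U P?) ⟨
    1 * countSublistsOfLength (x ∷ U) zero P? ∎
    where open ≡-Reasoning
  countInjectiveVecs≡!*countSublistsOfLength (x ∷ U) x∷U!@(_ ∷ U!) (suc b) {P} P? P-inv = begin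
    countInjectiveVecs (x ∷ U) (suc b) P?
      ≡⟨ countInjectiveVecs-∷ (Unique.Unique[x∷xs]⇒x∉xs x∷U!) U! P? P-inv b ⟩
    countInjectiveVecs U (suc b) P? + suc b * countInjectiveVecs U b Px?
      ≡⟨ cong₂ _+_ (countInjectiveVecs≡!*countSublistsOfLength U U! (suc b) P? P-inv)
                   (cong (suc b *_) (countInjectiveVecs≡!*countSublistsOfLength U U! b Px? (SetInvariant-∷ x P-inv))) ⟩
    suc b ! * countSublistsOfLength U (suc b) P? + suc b * (b ! * countSublistsOfLength U b Px?)
      ≡⟨ cong (suc b ! * countSublistsOfLength U (suc b) P? +_) (*-assoc (suc b) (b !) _) ⟨
    suc b ! * countSublistsOfLength U (suc b) P? + suc b ! * countSublistsOfLength U b Px?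
      ≡⟨ *-distribˡ-+ (suc b !) _ _ ⟨
    suc b ! * (countSublistsOfLength U (suc b) P? + countSublistsOfLength U b Px?)
      ≡⟨ cong (suc b ! *_) (countSublistsOfLength-∷-suc x U b P?) ⟨
    suc b ! * countSublistsOfLength (x ∷ U) (suc b) P? ∎
    where
    open ≡-Reasoning
    Px? : ∀ L → Dec (P (x ∷ L))
    Px? L = P? (x ∷ L)

-- 0/1 matrices with distinct nonzero rows and columns

Zero : ∀ {p} → (Fin p → Bool) → Set
Zero f = ∀ i → f i ≡ false

zero? : ∀ {p} (f : Fin p → Bool) → Dec (Zero f)
zero? f = Fin.all? λ i → f i Bool.≟ false

DistinctNonzeroRows : ∀ {q p} → (Fin q → Fin p → Bool) → Set
DistinctNonzeroRows e = (∀ j j′ → e j ≗ e j′ → j ≡ j′) × (∀ j → ¬ Zero (e j))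

distinctNonzeroRows? : ∀ {q p} (e : Fin q → Fin p → Bool) → Dec (DistinctNonzeroRows e)
distinctNonzeroRows? e =
  Fin.all? (λ j → Fin.all? λ j′ → Fin.all? (λ i → e j i Bool.≟ e j′ i) →-dec (j Fin.≟ j′))
  ×-dec Fin.all? (λ j → ¬? (zero? (e j)))

DistinctNonzeroRows-cong : ∀ {q p} {e e′ : Fin q → Fin p → Bool} → (∀ j → e j ≗ e′ j) →
  DistinctNonzeroRows e → DistinctNonzeroRows e′
DistinctNonzeroRows-cong e≗e′ (distinct , nonzero) =
  (λ j j′ e′ⱼ≗e′ⱼ′ → distinct j j′ (λ i → trans (e≗e′ j i) (trans (e′ⱼ≗e′ⱼ′ i) (sym (e≗e′ j′ i))))) ,
  (λ j e′ⱼ≡0 → nonzero j (λ i → trans (e≗e′ j i) (e′ⱼ≡0 i)))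

DistinctNonzeroLines : ∀ {q p} → (Fin q → Fin p → Bool) → Set
DistinctNonzeroLines e = DistinctNonzeroRows e × DistinctNonzeroRows (flip e)

Matrix : ℕ → ℕ → Set
Matrix q p = Vec (Subset p) q

entry : ∀ {q p} → Matrix q p → Fin q → Fin p → Bool
entry M j i = lookup (lookup M j) i

_ᵀ : ∀ {q p} → Matrix q p → Matrix p q
M ᵀ = tabulate λ i → tabulate λ j → entry M j i

entry-ᵀ : ∀ {q p} (M : Matrix q p) j i → entry (M ᵀ) i j ≡ entry M j i
entry-ᵀ M j i = trans (cong (λ row → lookup row j) (Vec.lookup∘tabulate _ i)) (Vec.lookup∘tabulate _ j)

ᵀ-involutive : ∀ {q p} (M : Matrix q p) → M ᵀ ᵀ ≡ M
ᵀ-involutive M = begin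
  tabulate (λ j → tabulate λ i → entry (M ᵀ) i j) ≡⟨ Vec.tabulate-cong (λ j → Vec.tabulate-cong (entry-ᵀ M j)) ⟩
  tabulate (λ j → tabulate (lookup (lookup M j)))  ≡⟨ Vec.tabulate-cong (λ j → Vec.tabulate∘lookup (lookup M j)) ⟩
  tabulate (lookup M)                              ≡⟨ Vec.tabulate∘lookup M ⟩
  M                                                ∎
  where open ≡-Reasoning

DistinctNonzeroLines-ᵀ : ∀ {q p} (M : Matrix q p) →
  DistinctNonzeroLines (entry M) → DistinctNonzeroLines (entry (M ᵀ))
DistinctNonzeroLines-ᵀ M (rows , columns) =
  DistinctNonzeroRows-cong (λ i j → sym (entry-ᵀ M j i)) columns ,
  DistinctNonzeroRows-cong (λ j i → sym (entry-ᵀ M j i)) rows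

distinctNonzeroLines? : ∀ {q p} (M : Matrix q p) → Dec (DistinctNonzeroLines (entry M))
distinctNonzeroLines? M = distinctNonzeroRows? (entry M) ×-dec distinctNonzeroRows? (flip (entry M))

countMatrices : ℕ → ℕ → ℕ
countMatrices q p = count distinctNonzeroLines? (vecsOver (allSubsets p) q)

countMatrices-comm : ∀ q p → countMatrices q p ≡ countMatrices p q
countMatrices-comm q p = count-≡-inverseOn distinctNonzeroLines? distinctNonzeroLines?
  (vecsOver (allSubsets p) q) (vecsOver (allSubsets q) p) _ᵀ _ᵀ
  (vecsOver-unique _ (allSubsets-unique p) q) (vecsOver-unique _ (allSubsets-unique q) p)
  (λ {M} _ M-ok → ∈-vecsOver⁺ _ (M ᵀ) (λ _ → allSubsets-complete _) , DistinctNonzeroLines-ᵀ M M-ok)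
  (λ {M} _ M-ok → ∈-vecsOver⁺ _ (M ᵀ) (λ _ → allSubsets-complete _) , DistinctNonzeroLines-ᵀ M M-ok)
  (λ {M} _ _ → ᵀ-involutive M) (λ {M} _ _ → ᵀ-involutive M)

SeparatingCover : ∀ p → List (Subset p) → Set
SeparatingCover p C =
  All (λ X → ¬ Zero (lookup X)) C ×
  (∀ i i′ → All (λ X → lookup X i ≡ lookup X i′) C → i ≡ i′) ×
  (∀ i → ¬ All (λ X → lookup X i ≡ false) C)

separatingCover? : ∀ p (C : List (Subset p)) → Dec (SeparatingCover p C)
separatingCover? p C =
  All.all? (λ X → ¬? (zero? (lookup X))) C
  ×-dec Fin.all? (λ i → Fin.all? λ i′ → All.all? (λ X → lookup X i Bool.≟ lookup X i′) C →-dec (i Fin.≟ i′))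
  ×-dec Fin.all? (λ i → ¬? (All.all? (λ X → lookup X i Bool.≟ false) C))

SeparatingCover-setInvariant : ∀ p → SetInvariant (SeparatingCover p)
SeparatingCover-setInvariant p C⊆C′ C′⊆C (nonzero , separating , covering) =
  restrict C′⊆C nonzero ,
  (λ i i′ → separating i i′ ∘ restrict C⊆C′) ,
  (λ i → covering i ∘ restrict C⊆C′)
  where
  restrict : ∀ {C C′ : List (Subset p)} {Q : Subset p → Set} → C ⊆ C′ → All Q C′ → All Q C
  restrict C⊆C′ all = All.tabulate (All.lookup all ∘ C⊆C′)

module _ {q p : ℕ} {M : Matrix q p} where

  private
    toList⁻ : {Q : Subset p → Set} → All Q (toList M) → ∀ j → Q (lookup M j)
    toList⁻ = VecAll.lookup⁺ ∘ VecAll.toList⁻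

    toList⁺ : {Q : Subset p → Set} → (∀ j → Q (lookup M j)) → All Q (toList M)
    toList⁺ = VecAll.toList⁺ ∘ VecAll.lookup⁻

  separatingCover⇒distinctNonzeroLines : LookupInjective M × SeparatingCover p (toList M) →
    DistinctNonzeroLines (entry M)
  separatingCover⇒distinctNonzeroLines (M! , nonzero , separating , covering) =
    ((λ j j′ → M! j j′ ∘ vecExt) , toList⁻ nonzero) ,
    ((λ i i′ → separating i i′ ∘ toList⁺) , (λ i → covering i ∘ toList⁺))
    where
    vecExt : ∀ {j j′} → entry M j ≗ entry M j′ → lookup M j ≡ lookup M j′
    vecExt eq = trans (sym (Vec.tabulate∘lookup _)) (trans (Vec.tabulate-cong eq) (Vec.tabulate∘lookup _))

  distinctNonzeroLines⇒separatingCover : DistinctNonzeroLines (entry M) →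
    LookupInjective M × SeparatingCover p (toList M)
  distinctNonzeroLines⇒separatingCover ((distinct , nonzero) , (separating , covering)) =
    (λ j j′ Mⱼ≡Mⱼ′ → distinct j j′ (λ i → cong (λ X → lookup X i) Mⱼ≡Mⱼ′)) ,
    toList⁺ nonzero , (λ i i′ → separating i i′ ∘ toList⁻) , (λ i → covering i ∘ toList⁻)

countInjectiveVecs-separatingCover≡countMatrices : ∀ q p →
  countInjectiveVecs _≟ˢ_ (allSubsets p) q (separatingCover? p) ≡ countMatrices q p
countInjectiveVecs-separatingCover≡countMatrices q p = cong length (List.filter-≐ _ distinctNonzeroLines?
  (separatingCover⇒distinctNonzeroLines , distinctNonzeroLines⇒separatingCover) (vecsOver (allSubsets p) q))

-- Separating families of proper bipartitions

infix 4 _∈ˢ?_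
_∈ˢ?_ : ∀ {n} (X : Subset n) (C : List (Subset n)) → Dec (X ∈ C)
_∈ˢ?_ = DecMembership._∈?_ _≟ˢ_

∁-involutive : ∀ {n} (X : Subset n) → ∁ (∁ X) ≡ X
∁-involutive []      = refl
∁-involutive (b ∷ X) = cong₂ _∷_ (Bool.not-involutive b) (∁-involutive X)

Cuts-∁ : ∀ {n} {X : Subset n} {i j} → Cuts X i j → Cuts (∁ X) i j
Cuts-∁ {X = X} {i} {j} cut ∁Xᵢ≡∁Xⱼ =
  cut (Bool.not-injective (trans (sym (Vec.lookup-map i not X)) (trans ∁Xᵢ≡∁Xⱼ (Vec.lookup-map j not X))))

count-∘∁ : ∀ {n} {Q : Pred (Subset n) 0ℓ} (Q? : Decidable Q) →
  count (λ X → Q? (∁ X)) (allSubsets n) ≡ count Q? (allSubsets n)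
count-∘∁ {n} {Q} Q? = count-≡-inverseOn (λ X → Q? (∁ X)) Q? (allSubsets n) (allSubsets n) ∁ ∁
  (allSubsets-unique n) (allSubsets-unique n)
  (λ _ Q∁X → allSubsets-complete _ , Q∁X)
  (λ {X} _ QX → allSubsets-complete _ , subst Q (sym (∁-involutive X)) QX)
  (λ {X} _ _ → ∁-involutive X) (λ {X} _ _ → ∁-involutive X)

Closed : ∀ {n} → List (Subset n) → Set
Closed C = All (λ X → ∁ X ∈ C) C

Nonempty-false∷⁺ : ∀ {p} (X : Subset p) → ¬ Zero (lookup X) → Nonempty (false ∷ X)
Nonempty-false∷⁺ {p} X X≢0 with i , Xᵢ≢false ← Fin.¬∀⟶∃¬ p _ (λ i → lookup X i Bool.≟ false) X≢0 =
  suc i , Vec.lookup⇒[]= (suc i) (false ∷ X) (Bool.¬-not Xᵢ≢false)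

Nonempty-true∷ : ∀ {p} (X : Subset p) → Nonempty (true ∷ X)
Nonempty-true∷ X = zero , Vec.lookup⇒[]= zero (true ∷ X) refl

Nonempty-false∷⁻ : ∀ {p} (X : Subset p) → Nonempty (false ∷ X) → ¬ Zero (lookup X)
Nonempty-false∷⁻ X (zero , ())
Nonempty-false∷⁻ X (suc i , X∋i) X≡0 with () ← trans (sym (Vec.[]=⇒lookup X∋i)) (X≡0 i)

module _ {p : ℕ} where

  avoidingZero : List (Subset (suc p)) → List (Subset p)
  avoidingZero C = filter (λ X → false ∷ X ∈ˢ? C) (allSubsets p)

  ∈-avoidingZero⁺ : ∀ {C X} → false ∷ X ∈ C → X ∈ avoidingZero C
  ∈-avoidingZero⁺ {C} {X} = ∈-filter⁺ (λ X → false ∷ X ∈ˢ? C) (allSubsets-complete X)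

  ∈-avoidingZero⁻ : ∀ {C X} → X ∈ avoidingZero C → false ∷ X ∈ C
  ∈-avoidingZero⁻ {C} = proj₂ ∘ ∈-filter⁻ (λ X → false ∷ X ∈ˢ? C) {xs = allSubsets p}

  ComponentOf : List (Subset p) → Subset (suc p) → Set
  ComponentOf A (false ∷ X) = X ∈ A
  ComponentOf A (true ∷ X)  = ∁ X ∈ A

  componentOf? : (A : List (Subset p)) → Decidable (ComponentOf A)
  componentOf? A (false ∷ X) = X ∈ˢ? A
  componentOf? A (true ∷ X)  = ∁ X ∈ˢ? A

  withComplements : List (Subset p) → List (Subset (suc p))
  withComplements A = filter (componentOf? A) (allSubsets (suc p))

  ∈-withComplements⁺ : ∀ {A Y} → ComponentOf A Y → Y ∈ withComplements A
  ∈-withComplements⁺ {A} {Y} = ∈-filter⁺ (componentOf? A) (allSubsets-complete Y)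

  ∈-withComplements⁻ : ∀ {A Y} → Y ∈ withComplements A → ComponentOf A Y
  ∈-withComplements⁻ {A} = proj₂ ∘ ∈-filter⁻ (componentOf? A) {xs = allSubsets (suc p)}

  length-withComplements : ∀ {A} → A ∈ sublists (allSubsets p) → length (withComplements A) ≡ 2 * length A
  length-withComplements {A} A∈ = begin
    count (componentOf? A) (map (false ∷_) (allSubsets p) ++ map (true ∷_) (allSubsets p))
      ≡⟨ count-++ (componentOf? A) (map (false ∷_) (allSubsets p)) _ ⟩
    count (componentOf? A) (map (false ∷_) (allSubsets p)) + count (componentOf? A) (map (true ∷_) (allSubsets p))
      ≡⟨ cong₂ _+_ (count-map (componentOf? A) (false ∷_) (allSubsets p)) (count-map (componentOf? A) (true ∷_) (allSubsets p)) ⟩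
    count (_∈ˢ? A) (allSubsets p) + count (λ X → ∁ X ∈ˢ? A) (allSubsets p)
      ≡⟨ cong (count (_∈ˢ? A) (allSubsets p) +_) (count-∘∁ (_∈ˢ? A)) ⟩
    count (_∈ˢ? A) (allSubsets p) + count (_∈ˢ? A) (allSubsets p)
      ≡⟨ cong (λ n → n + n) (cong length (sublist≡filter-∈ _≟ˢ_ (allSubsets p) (allSubsets-unique p) A∈)) ⟨
    length A + length A
      ≡⟨ cong (length A +_) (+-identityʳ (length A)) ⟨
    2 * length A ∎
    where open ≡-Reasoning

  avoidingZero∘withComplements : ∀ {A} → A ∈ sublists (allSubsets p) → avoidingZero (withComplements A) ≡ A
  avoidingZero∘withComplements {A} A∈ = begin
    filter (λ X → false ∷ X ∈ˢ? withComplements A) (allSubsets p)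
      ≡⟨ List.filter-≐ _ (_∈ˢ? A) (∈-withComplements⁻ , ∈-withComplements⁺) (allSubsets p) ⟩
    filter (_∈ˢ? A) (allSubsets p)
      ≡⟨ sublist≡filter-∈ _≟ˢ_ (allSubsets p) (allSubsets-unique p) A∈ ⟨
    A ∎
    where open ≡-Reasoning

  withComplements∘avoidingZero : ∀ {C} → C ∈ sublists (allSubsets (suc p)) → Closed C →
    withComplements (avoidingZero C) ≡ C
  withComplements∘avoidingZero {C} C∈ closed = begin
    filter (componentOf? (avoidingZero C)) (allSubsets (suc p))
      ≡⟨ List.filter-≐ _ (_∈ˢ? C) (component⇒∈ _ , ∈⇒component _) (allSubsets (suc p)) ⟩
    filter (_∈ˢ? C) (allSubsets (suc p))
      ≡⟨ sublist≡filter-∈ _≟ˢ_ (allSubsets (suc p)) (allSubsets-unique (suc p)) C∈ ⟨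
    C ∎
    where
    open ≡-Reasoning
    component⇒∈ : ∀ Y → ComponentOf (avoidingZero C) Y → Y ∈ C
    component⇒∈ (false ∷ X) X∈ = ∈-avoidingZero⁻ X∈
    component⇒∈ (true ∷ X) ∁X∈ =
      subst (λ Z → true ∷ Z ∈ C) (∁-involutive X) (All.lookup closed (∈-avoidingZero⁻ ∁X∈))
    ∈⇒component : ∀ Y → Y ∈ C → ComponentOf (avoidingZero C) Y
    ∈⇒component (false ∷ X) Y∈ = ∈-avoidingZero⁺ Y∈
    ∈⇒component (true ∷ X) Y∈  = ∈-avoidingZero⁺ (All.lookup closed Y∈)

  avoidingZero-cut : ∀ {C} → Closed C → ∀ {X i j} → X ∈ C → Cuts X i j →
    ∃ λ Y → Y ∈ avoidingZero C × Cuts (false ∷ Y) i j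
  avoidingZero-cut closed {false ∷ Y}         X∈ cut = Y , ∈-avoidingZero⁺ X∈ , cut
  avoidingZero-cut closed {true ∷ Y} {i} {j} X∈ cut =
    ∁ Y , ∈-avoidingZero⁺ (All.lookup closed X∈) , Cuts-∁ {X = true ∷ Y} {i} {j} cut

  avoidingZero-separatingCover : ∀ {q C} → IsSepFamily (suc p) q C → SeparatingCover p (avoidingZero C)
  avoidingZero-separatingCover {C = C} ((proper , closed , _) , separating) = nonzero , distinguishes , covers
    where
    cutAvoiding : ∀ i j → i ≢ j → ∃ λ Y → Y ∈ avoidingZero C × Cuts (false ∷ Y) i j
    cutAvoiding i j i≢j = let _ , X∈ , cut = find (separating i j i≢j) in avoidingZero-cut closed X∈ cut

    nonzero : All (λ X → ¬ Zero (lookup X)) (avoidingZero C)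
    nonzero = All.tabulate λ {X} X∈ → Nonempty-false∷⁻ X (proj₁ (All.lookup proper (∈-avoidingZero⁻ X∈)))

    distinguishes : ∀ i i′ → All (λ X → lookup X i ≡ lookup X i′) (avoidingZero C) → i ≡ i′
    distinguishes i i′ same with i Fin.≟ i′
    ... | yes i≡i′ = i≡i′
    ... | no i≢i′  = let _ , Y∈ , cut = cutAvoiding (suc i) (suc i′) (i≢i′ ∘ Fin.suc-injective) in
                     ⊥-elim (cut (All.lookup same Y∈))

    covers : ∀ i → ¬ All (λ X → lookup X i ≡ false) (avoidingZero C)
    covers i none = let _ , Y∈ , cut = cutAvoiding zero (suc i) (λ ()) in cut (sym (All.lookup none Y∈))

  length-avoidingZero : ∀ {q C} → C ∈ sublists (allSubsets (suc p)) → IsSepFamily (suc p) q C →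
    length (avoidingZero C) ≡ q
  length-avoidingZero {q} {C} C∈ ((_ , closed , length≡2q) , _) = *-cancelˡ-≡ (length (avoidingZero C)) q 2 (begin
    2 * length (avoidingZero C)                 ≡⟨ length-withComplements (filter∈sublists _ (allSubsets p)) ⟨
    length (withComplements (avoidingZero C))   ≡⟨ cong length (withComplements∘avoidingZero C∈ closed) ⟩
    length C                                    ≡⟨ length≡2q ⟩
    2 * q                                       ∎)
    where open ≡-Reasoning

  withComplements-isSepFamily : ∀ {q A} → A ∈ sublists (allSubsets p) → length A ≡ q → SeparatingCover p A →
    IsSepFamily (suc p) q (withComplements A)
  withComplements-isSepFamily {q} {A} A∈ length≡q (nonzero , distinguishes , covers) =
    (All.tabulate (λ {Y} → proper Y ∘ ∈-withComplements⁻) ,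
     All.tabulate (λ {Y} → ∈-withComplements⁺ {A} {∁ Y} ∘ closed Y ∘ ∈-withComplements⁻) ,
     trans (length-withComplements A∈) (cong (2 *_) length≡q)) ,
    separating
    where
    proper : ∀ Y → ComponentOf A Y → Nonempty Y × Nonempty (∁ Y)
    proper (false ∷ X) X∈  = Nonempty-false∷⁺ X (All.lookup nonzero X∈) , Nonempty-true∷ (∁ X)
    proper (true ∷ X)  ∁X∈ = Nonempty-true∷ X , Nonempty-false∷⁺ (∁ X) (All.lookup nonzero ∁X∈)

    closed : ∀ Y → ComponentOf A Y → ComponentOf A (∁ Y)
    closed (false ∷ X) X∈  = subst (_∈ A) (sym (∁-involutive X)) X∈
    closed (true ∷ X)  ∁X∈ = ∁X∈

    cut : ∀ {X i j} → X ∈ A → Cuts (false ∷ X) i j → Any (λ Y → Cuts Y i j) (withComplements A)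
    cut {X} X∈ = lose (∈-withComplements⁺ {A} {false ∷ X} X∈)

    separating : Separating (suc p) (withComplements A)
    separating zero zero 0≢0 = ⊥-elim (0≢0 refl)
    separating zero (suc j) _ =
      let _ , X∈ , Xⱼ≢false = find (¬All⇒Any¬ (λ X → lookup X j Bool.≟ false) A (covers j)) in cut X∈ (Xⱼ≢false ∘ sym)
    separating (suc i) zero _ =
      let _ , X∈ , Xᵢ≢false = find (¬All⇒Any¬ (λ X → lookup X i Bool.≟ false) A (covers i)) in cut X∈ Xᵢ≢false
    separating (suc i) (suc j) i≢j =
      let _ , X∈ , Xᵢ≢Xⱼ = find (¬All⇒Any¬ (λ X → lookup X i Bool.≟ lookup X j) A (i≢j ∘ cong suc ∘ distinguishes i j))
      in cut X∈ Xᵢ≢Xⱼ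

  σ-suc≡countSeparatingCovers : ∀ q → σ (suc p) q ≡ countSublistsOfLength _≟ˢ_ (allSubsets p) q (separatingCover? p)
  σ-suc≡countSeparatingCovers q = count-≡-inverseOn
    (isSepFamily? (suc p) q) (λ A → (length A ℕ.≟ q) ×-dec separatingCover? p A)
    (sublists (allSubsets (suc p))) (sublists (allSubsets p)) avoidingZero withComplements
    (sublists-unique _ (allSubsets-unique (suc p))) (sublists-unique _ (allSubsets-unique p))
    (λ C∈ sep → filter∈sublists _ (allSubsets p) , length-avoidingZero {q} C∈ sep , avoidingZero-separatingCover {q} sep)
    (λ A∈ (length≡q , cover) → filter∈sublists _ (allSubsets (suc p)) , withComplements-isSepFamily A∈ length≡q cover)
    (λ C∈ ((_ , closed , _) , _) → withComplements∘avoidingZero C∈ closed)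
    (λ A∈ _ → avoidingZero∘withComplements A∈)

σ-suc*!≡countMatrices : ∀ p q → σ (suc p) q * q ! ≡ countMatrices q p
σ-suc*!≡countMatrices p q = begin
  σ (suc p) q * q !
    ≡⟨ cong (_* q !) (σ-suc≡countSeparatingCovers {p} q) ⟩
  countSublistsOfLength _≟ˢ_ (allSubsets p) q (separatingCover? p) * q !
    ≡⟨ *-comm _ (q !) ⟩
  q ! * countSublistsOfLength _≟ˢ_ (allSubsets p) q (separatingCover? p)
    ≡⟨ countInjectiveVecs≡!*countSublistsOfLength _≟ˢ_ (allSubsets p) (allSubsets-unique p) q
         (separatingCover? p) (SeparatingCover-setInvariant p) ⟨
  countInjectiveVecs _≟ˢ_ (allSubsets p) q (separatingCover? p)
    ≡⟨ countInjectiveVecs-separatingCover≡countMatrices q p ⟩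
  countMatrices q p ∎
  where open ≡-Reasoning

lemma3p14 : ∀ (n k : ℕ) → 2 ≤ n → 2 ≤ k → k ≤ 2 ^ (n ∸ 1) →
    σ n (k ∸ 1) * (k ∸ 1) ! ≡ σ k (n ∸ 1) * (n ∸ 1) !
lemma3p14 zero    _       () _  _
lemma3p14 (suc p) zero    _  () _
lemma3p14 (suc p) (suc q) _  _  _ = begin
  σ (suc p) q * q ! ≡⟨ σ-suc*!≡countMatrices p q ⟩
  countMatrices q p ≡⟨ countMatrices-comm q p ⟩
  countMatrices p q ≡⟨ σ-suc*!≡countMatrices q p ⟨
  σ (suc q) p * p ! ∎
  where open ≡-Reasoning
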